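{- Let $\mathbf A=(A,\wedge,\vee,\cdot,\backslash,\slash)$ be a residuated binar whose lattice reduct is distributive. Consider the identities \begin{itemize} \item[$(\cdot\wedge)$] $x (y\wedge z) = x y\wedge x z$, \item[$(\wedge\cdot)$] $(x\wedge y) z = x z\wedge y z$, \item[$(\backslash\vee)$] $x\backslash (y\vee z) = x\backslash y\vee x\backslash z$, \item[$(\vee\slash)$] $(x\vee y)\slash z = x\slash z\vee y\slash z$, \item[$(\wedge\backslash)$] $(x\wedge y)\backslash z = x\backslash z\vee y\backslash z$, \item[$(\slash\wedge)$] $x\slash (y\wedge z) = x\slash y\vee x\slash z$. \end{itemize} Then: \begin{enumerate} \item If $\mathbf A$ satisfies both $(\vee\slash)$ and $(\wedge\backslash)$, then $\mathbf A$ satisfies $(\backslash\vee)$. \item If $\mathbf A$ satisfies both $(\backslash\vee)$ and $(\slash\wedge)$, then $\mathbf A$ satisfies $(\vee\slash)$. \item If $\mathbf A$ satisfies both $(\cdot\wedge)$ and $(\vee\slash)$, then $\mathbf A$ satisfies $(\slash\wedge)$. \item If $\mathbf A$ satisfies both $(\wedge\cdot)$ and $(\backslash\vee)$, then $\mathbf A$ satisfies $(\wedge\backslash)$. \item If $\mathbf A$ satisfies both $(\wedge\backslash)$ and $(\cdot\wedge)$, then $\mathbf A$ satisfies $(\wedge\cdot)$. \item If $\mathbf A$ satisfies both $(\slash\wedge)$ and $(\wedge\cdot)$, then $\mathbf A$ satisfies $(\cdot\wedge)$. \end{enumerate}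
   Context: A residuated binar is an algebra $\mathbf A=(A,\wedge,\vee,\cdot,\backslash,\slash)$ where $(A,\wedge,\vee)$ is a lattice, $\cdot$ is a binary operation on $A$ (written $xy$), and for all $x,y,z\in A$: $x\cdot y\le z \iff x\le z\slash y \iff y\le x\backslash z$. Convention: $\cdot$ binds more tightly than $\backslash,\slash$, which bind more tightly than $\wedge,\vee$. "Satisfies an identity" means it holds for all values of the variables in $A$. -}

module Defs where

open import Level using (Level; suc; _⊔_)
open import Algebra.Core using (Op₂)
open import Algebra.Lattice.Bundles using (DistributiveLattice)
open import Function.Bundles using (_⇔_)

record DistributiveResiduatedBinar c ℓ : Set (suc (c ⊔ ℓ)) where
  infixl 8 _·_
  infixr 7 _\\_
  infixl 7 _/_
  field
    distributiveLattice : DistributiveLattice c ℓ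
  open DistributiveLattice distributiveLattice public
  infix 4 _≤_
  _≤_ : Carrier → Carrier → Set ℓ
  x ≤ y = (x ∧ y) ≈ x
  field
    _·_  : Op₂ Carrier
    _\\_ : Op₂ Carrier
    _/_  : Op₂ Carrier
    residuated-/ : ∀ x y z → (x · y ≤ z) ⇔ (x ≤ z / y)
    residuated-\\ : ∀ x y z → (x · y ≤ z) ⇔ (y ≤ x \\ z)

module _ {c ℓ : Level} (A : DistributiveResiduatedBinar c ℓ) where
  open DistributiveResiduatedBinar A

  ·∧-id : Set (c ⊔ ℓ)
  ·∧-id = ∀ x y z → x · (y ∧ z) ≈ (x · y) ∧ (x · z)
  ∧·-id : Set (c ⊔ ℓ)
  ∧·-id = ∀ x y z → (x ∧ y) · z ≈ (x · z) ∧ (y · z)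
  \\∨-id : Set (c ⊔ ℓ)
  \\∨-id = ∀ x y z → x \\ (y ∨ z) ≈ (x \\ y) ∨ (x \\ z)
  ∨/-id : Set (c ⊔ ℓ)
  ∨/-id = ∀ x y z → (x ∨ y) / z ≈ (x / z) ∨ (y / z)
  ∧\\-id : Set (c ⊔ ℓ)
  ∧\\-id = ∀ x y z → (x ∧ y) \\ z ≈ (x \\ z) ∨ (y \\ z)
  /∧-id : Set (c ⊔ ℓ)
  /∧-id = ∀ x y z → x / (y ∧ z) ≈ (x / y) ∨ (x / z)

{-# OPTIONS --safe #-}
module Submission where

-- Every nontrivial inequality comes from one device: in a distributive lattice an element w below
-- p ∨ q is the join of w ∧ p and w ∧ q.  The assumed identities turn a residual or a product into
-- such a join, and residuation bounds each of the two pieces separately.  The mirror image of a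
-- residuated binar (reverse the product, exchange \ and /) swaps the identities in pairs, so half
-- of the six implications are the mirror images of the other half.

open import Defs
open import Level using (Level)
open import Data.Product using (_×_; _,_)
open import Function.Bundles using (Equivalence)
open import Relation.Binary.Core using (Rel)
open import Algebra.Lattice.Bundles using (Lattice; DistributiveLattice)
import Algebra.Lattice.Properties.Lattice as LatticeProperties
import Relation.Binary.Lattice as OrderTheoretic

module LatticeOrder {c ℓ : Level} (L : Lattice c ℓ) where
  open Lattice L
  open LatticeProperties L using (∨-∧-isOrderTheoreticLattice)
  private module O = OrderTheoretic.IsLattice ∨-∧-isOrderTheoreticLattice

  -- The library's natural order is x ≈ x ∧ y; this is the same order with the equation flipped.
  infix 4 _≤_
  _≤_ : Rel Carrier ℓ
  x ≤ y = x ∧ y ≈ x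

  ≤-refl : ∀ {x} → x ≤ x
  ≤-refl = sym O.refl

  ≤-reflexive : ∀ {x y} → x ≈ y → x ≤ y
  ≤-reflexive x≈y = sym (O.reflexive x≈y)

  ≤-trans : ∀ {x y z} → x ≤ y → y ≤ z → x ≤ z
  ≤-trans x≤y y≤z = sym (O.trans (sym x≤y) (sym y≤z))

  ≤-antisym : ∀ {x y} → x ≤ y → y ≤ x → x ≈ y
  ≤-antisym x≤y y≤x = O.antisym (sym x≤y) (sym y≤x)

  x∧y≤x : ∀ {x y} → x ∧ y ≤ x
  x∧y≤x {x} {y} = sym (O.x∧y≤x x y)

  x∧y≤y : ∀ {x y} → x ∧ y ≤ y
  x∧y≤y {x} {y} = sym (O.x∧y≤y x y)

  ∧-greatest : ∀ {x y z} → x ≤ y → x ≤ z → x ≤ y ∧ z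
  ∧-greatest x≤y x≤z = sym (O.∧-greatest (sym x≤y) (sym x≤z))

  x≤x∨y : ∀ {x y} → x ≤ x ∨ y
  x≤x∨y {x} {y} = sym (O.x≤x∨y x y)

  y≤x∨y : ∀ {x y} → y ≤ x ∨ y
  y≤x∨y {x} {y} = sym (O.y≤x∨y x y)

  ∨-least : ∀ {x y z} → x ≤ z → y ≤ z → x ∨ y ≤ z
  ∨-least x≤z y≤z = sym (O.∨-least (sym x≤z) (sym y≤z))

module DistributiveLatticeOrder {c ℓ : Level} (L : DistributiveLattice c ℓ) where
  open DistributiveLattice L
  open LatticeOrder lattice

  ∧-∨-subdistribˡ : ∀ {x y z} → x ∧ (y ∨ z) ≤ (x ∧ y) ∨ (x ∧ z)
  ∧-∨-subdistribˡ {x} {y} {z} = ≤-reflexive (∧-distribˡ-∨ x y z)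

  ≤∨⇒≤∧∨∧ : ∀ {w x y} → w ≤ x ∨ y → w ≤ (w ∧ x) ∨ (w ∧ y)
  ≤∨⇒≤∧∨∧ w≤x∨y = ≤-trans (∧-greatest ≤-refl w≤x∨y) ∧-∨-subdistribˡ

  ∨-∧-∨-least : ∀ {p q r s t} → p ≤ t → s ≤ t → q ∧ r ≤ t → (p ∨ q) ∧ (r ∨ s) ≤ t
  ∨-∧-∨-least p≤t s≤t q∧r≤t =
    ≤-trans ∧-∨-subdistribˡ (∨-least (≤-trans ∨∧-≤-∨∧ (∨-least p≤t q∧r≤t))
                                     (≤-trans x∧y≤y s≤t))
    where
    ∨∧-≤-∨∧ : ∀ {p q r} → (p ∨ q) ∧ r ≤ p ∨ (q ∧ r)
    ∨∧-≤-∨∧ = ≤-trans (∧-greatest x∧y≤y x∧y≤x)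
                               (≤-trans ∧-∨-subdistribˡ
                                 (∨-least (≤-trans x∧y≤y x≤x∨y) (≤-trans (∧-greatest x∧y≤y x∧y≤x) y≤x∨y)))

module ResiduatedBinarProperties {c ℓ : Level} (A : DistributiveResiduatedBinar c ℓ) where
  open DistributiveResiduatedBinar A hiding (_≤_)
  open LatticeOrder lattice public
  open DistributiveLatticeOrder distributiveLattice public

  ·≤⇒≤/ : ∀ {x y z} → x · y ≤ z → x ≤ z / y
  ·≤⇒≤/ {x} {y} {z} = Equivalence.to (residuated-/ x y z)

  ≤/⇒·≤ : ∀ {x y z} → x ≤ z / y → x · y ≤ z
  ≤/⇒·≤ {x} {y} {z} = Equivalence.from (residuated-/ x y z)

  ·≤⇒≤\\ : ∀ {x y z} → x · y ≤ z → y ≤ x \\ z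
  ·≤⇒≤\\ {x} {y} {z} = Equivalence.to (residuated-\\ x y z)

  ≤\\⇒·≤ : ∀ {x y z} → y ≤ x \\ z → x · y ≤ z
  ≤\\⇒·≤ {x} {y} {z} = Equivalence.from (residuated-\\ x y z)

  /-counit : ∀ {x y} → (y / x) · x ≤ y
  /-counit = ≤/⇒·≤ ≤-refl

  \\-counit : ∀ {x y} → x · (x \\ y) ≤ y
  \\-counit = ≤\\⇒·≤ ≤-refl

  ·-monoˡ-≤ : ∀ {x x′ y} → x ≤ x′ → x · y ≤ x′ · y
  ·-monoˡ-≤ x≤x′ = ≤/⇒·≤ (≤-trans x≤x′ (·≤⇒≤/ ≤-refl))

  ·-monoʳ-≤ : ∀ {x y y′} → y ≤ y′ → x · y ≤ x · y′
  ·-monoʳ-≤ y≤y′ = ≤\\⇒·≤ (≤-trans y≤y′ (·≤⇒≤\\ ≤-refl))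

  \\-monoʳ-≤ : ∀ {x y y′} → y ≤ y′ → x \\ y ≤ x \\ y′
  \\-monoʳ-≤ y≤y′ = ·≤⇒≤\\ (≤-trans \\-counit y≤y′)

  /-antiʳ-≤ : ∀ {x y y′} → y ≤ y′ → x / y′ ≤ x / y
  /-antiʳ-≤ y≤y′ = ·≤⇒≤/ (≤-trans (·-monoʳ-≤ y≤y′) /-counit)

  ·-∨-subdistribʳ : ∀ {x y z} → (y ∨ z) · x ≤ y · x ∨ z · x
  ·-∨-subdistribʳ = ≤/⇒·≤ (∨-least (·≤⇒≤/ x≤x∨y) (·≤⇒≤/ y≤x∨y))

  ·-∨-subdistribˡ : ∀ {x y z} → x · (y ∨ z) ≤ x · y ∨ x · z
  ·-∨-subdistribˡ = ≤\\⇒·≤ (∨-least (·≤⇒≤\\ x≤x∨y) (·≤⇒≤\\ y≤x∨y))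

  ∨/-∧\\⇒\\∨ : ∨/-id A → ∧\\-id A → \\∨-id A
  ∨/-∧\\⇒\\∨ ∨/ ∧\\ x y z = ≤-antisym w≤x\\y∨x\\z (∨-least (\\-monoʳ-≤ x≤x∨y) (\\-monoʳ-≤ y≤x∨y))
    where
    w a b : Carrier
    w = x \\ (y ∨ z)
    a = x ∧ (y / w)
    b = x ∧ (z / w)

    x≤a∨b : x ≤ a ∨ b
    x≤a∨b = ≤∨⇒≤∧∨∧ (≤-trans (·≤⇒≤/ \\-counit) (≤-reflexive (∨/ y z w)))

    a·w≤y : a · w ≤ y
    a·w≤y = ≤-trans (·-monoˡ-≤ x∧y≤y) /-counit

    b·w≤z : b · w ≤ z
    b·w≤z = ≤-trans (·-monoˡ-≤ x∧y≤y) /-counit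

    x·≤-by-cases : ∀ {u t} → a · u ≤ t → b · u ≤ t → x · u ≤ t
    x·≤-by-cases a·u≤t b·u≤t =
      ≤-trans (·-monoˡ-≤ x≤a∨b) (≤-trans ·-∨-subdistribʳ (∨-least a·u≤t b·u≤t))

    w≤a\\y∧z∨b\\y∧z : w ≤ (a \\ (y ∧ z)) ∨ (b \\ (y ∧ z))
    w≤a\\y∧z∨b\\y∧z = ≤-trans (·≤⇒≤\\ a∧b·w≤y∧z) (≤-reflexive (∧\\ a b (y ∧ z)))
      where
      a∧b·w≤y∧z : (a ∧ b) · w ≤ y ∧ z
      a∧b·w≤y∧z = ∧-greatest (≤-trans (·-monoˡ-≤ x∧y≤x) a·w≤y) (≤-trans (·-monoˡ-≤ x∧y≤y) b·w≤z)

    w∧a\\y∧z≤x\\z : w ∧ (a \\ (y ∧ z)) ≤ x \\ z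
    w∧a\\y∧z≤x\\z = ·≤⇒≤\\ (x·≤-by-cases (≤-trans (·-monoʳ-≤ x∧y≤y) (≤-trans \\-counit x∧y≤y))
                                          (≤-trans (·-monoʳ-≤ x∧y≤x) b·w≤z))

    w∧b\\y∧z≤x\\y : w ∧ (b \\ (y ∧ z)) ≤ x \\ y
    w∧b\\y∧z≤x\\y = ·≤⇒≤\\ (x·≤-by-cases (≤-trans (·-monoʳ-≤ x∧y≤x) a·w≤y)
                                          (≤-trans (·-monoʳ-≤ x∧y≤y) (≤-trans \\-counit x∧y≤x)))

    w≤x\\y∨x\\z : w ≤ (x \\ y) ∨ (x \\ z)
    w≤x\\y∨x\\z = ≤-trans (≤∨⇒≤∧∨∧ w≤a\\y∧z∨b\\y∧z)
                          (∨-least (≤-trans w∧a\\y∧z≤x\\z y≤x∨y) (≤-trans w∧b\\y∧z≤x\\y x≤x∨y))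

  ·∧-∨/⇒/∧ : ·∧-id A → ∨/-id A → /∧-id A
  ·∧-∨/⇒/∧ ·∧ ∨/ x y z = ≤-antisym w≤x/y∨x/z (∨-least (/-antiʳ-≤ x∧y≤x) (/-antiʳ-≤ x∧y≤y))
    where
    w p q : Carrier
    w = x / (y ∧ z)
    p = (w · y) / (y ∨ z)
    q = (w · z) / (y ∨ z)

    w·y∧w·z≤x : (w · y) ∧ (w · z) ≤ x
    w·y∧w·z≤x = ≤-trans (≤-reflexive (sym (·∧ w y z))) /-counit

    w≤p∨q : w ≤ p ∨ q
    w≤p∨q = ≤-trans (·≤⇒≤/ ·-∨-subdistribˡ) (≤-reflexive (∨/ (w · y) (w · z) (y ∨ z)))

    w∧p≤x/z : w ∧ p ≤ x / z
    w∧p≤x/z = ·≤⇒≤/ (≤-trans (∧-greatest w∧p·z≤w·y (·-monoˡ-≤ x∧y≤x)) w·y∧w·z≤x)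
      where
      w∧p·z≤w·y : (w ∧ p) · z ≤ w · y
      w∧p·z≤w·y = ≤-trans (·-monoʳ-≤ y≤x∨y) (≤-trans (·-monoˡ-≤ x∧y≤y) /-counit)

    w∧q≤x/y : w ∧ q ≤ x / y
    w∧q≤x/y = ·≤⇒≤/ (≤-trans (∧-greatest (·-monoˡ-≤ x∧y≤x) w∧q·y≤w·z) w·y∧w·z≤x)
      where
      w∧q·y≤w·z : (w ∧ q) · y ≤ w · z
      w∧q·y≤w·z = ≤-trans (·-monoʳ-≤ x≤x∨y) (≤-trans (·-monoˡ-≤ x∧y≤y) /-counit)

    w≤x/y∨x/z : w ≤ (x / y) ∨ (x / z)
    w≤x/y∨x/z = ≤-trans (≤∨⇒≤∧∨∧ w≤p∨q) (∨-least (≤-trans w∧p≤x/z y≤x∨y) (≤-trans w∧q≤x/y x≤x∨y))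

  ∧\\-·∧⇒∧· : ∧\\-id A → ·∧-id A → ∧·-id A
  ∧\\-·∧⇒∧· ∧\\ ·∧ x y z = ≤-antisym (∧-greatest (·-monoˡ-≤ x∧y≤x) (·-monoˡ-≤ x∧y≤y)) x·z∧y·z≤t
    where
    t z₁ z₂ : Carrier
    t = (x ∧ y) · z
    z₁ = z ∧ (x \\ t)
    z₂ = z ∧ (y \\ t)

    z≤z₁∨z₂ : z ≤ z₁ ∨ z₂
    z≤z₁∨z₂ = ≤∨⇒≤∧∨∧ (≤-trans (·≤⇒≤\\ ≤-refl) (≤-reflexive (∧\\ x y t)))

    ·z≤·z₁∨·z₂ : ∀ {u} → u · z ≤ u · z₁ ∨ u · z₂
    ·z≤·z₁∨·z₂ = ≤-trans (·-monoʳ-≤ z≤z₁∨z₂) ·-∨-subdistribˡ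

    x·z₁≤t : x · z₁ ≤ t
    x·z₁≤t = ≤-trans (·-monoʳ-≤ x∧y≤y) \\-counit

    y·z₂≤t : y · z₂ ≤ t
    y·z₂≤t = ≤-trans (·-monoʳ-≤ x∧y≤y) \\-counit

    x·z₂∧y·z₁≤t : x · z₂ ∧ y · z₁ ≤ t
    x·z₂∧y·z₁≤t = ≤-trans x·z₂∧y·z₁≤[x∨y]·z₂∧z₁
                          (≤-trans ·-∨-subdistribʳ (∨-least (≤-trans (·-monoʳ-≤ x∧y≤y) x·z₁≤t)
                                                             (≤-trans (·-monoʳ-≤ x∧y≤x) y·z₂≤t)))
      where
      x·z₂∧y·z₁≤[x∨y]·z₂∧z₁ : x · z₂ ∧ y · z₁ ≤ (x ∨ y) · (z₂ ∧ z₁)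
      x·z₂∧y·z₁≤[x∨y]·z₂∧z₁ =
        ≤-trans (∧-greatest (≤-trans x∧y≤x (·-monoˡ-≤ x≤x∨y)) (≤-trans x∧y≤y (·-monoˡ-≤ y≤x∨y)))
                (≤-reflexive (sym (·∧ (x ∨ y) z₂ z₁)))

    x·z∧y·z≤t : x · z ∧ y · z ≤ t
    x·z∧y·z≤t = ≤-trans (∧-greatest (≤-trans x∧y≤x ·z≤·z₁∨·z₂) (≤-trans x∧y≤y ·z≤·z₁∨·z₂))
                        (∨-∧-∨-least x·z₁≤t y·z₂≤t x·z₂∧y·z₁≤t)

mirror : {c ℓ : Level} → DistributiveResiduatedBinar c ℓ → DistributiveResiduatedBinar c ℓ
mirror A = record
  { distributiveLattice = distributiveLattice
  ; _·_ = λ x y → y · x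
  ; _\\_ = λ x z → z / x
  ; _/_ = λ z y → y \\ z
  ; residuated-/ = λ x y z → residuated-\\ y x z
  ; residuated-\\ = λ x y z → residuated-/ y x z
  }
  where open DistributiveResiduatedBinar A

-- mirror is definitionally an involution, so each lemma below also transports identities back from mirror A.
module MirrorProperties {c ℓ : Level} (A : DistributiveResiduatedBinar c ℓ) where

  ·∧⇒mirror-∧· : ·∧-id A → ∧·-id (mirror A)
  ·∧⇒mirror-∧· ·∧ x y z = ·∧ z x y

  ∧·⇒mirror-·∧ : ∧·-id A → ·∧-id (mirror A)
  ∧·⇒mirror-·∧ ∧· x y z = ∧· y z x

  \\∨⇒mirror-∨/ : \\∨-id A → ∨/-id (mirror A)
  \\∨⇒mirror-∨/ \\∨ x y z = \\∨ z x y

  ∨/⇒mirror-\\∨ : ∨/-id A → \\∨-id (mirror A)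
  ∨/⇒mirror-\\∨ ∨/ x y z = ∨/ y z x

  ∧\\⇒mirror-/∧ : ∧\\-id A → /∧-id (mirror A)
  ∧\\⇒mirror-/∧ ∧\\ x y z = ∧\\ y z x

  /∧⇒mirror-∧\\ : /∧-id A → ∧\\-id (mirror A)
  /∧⇒mirror-∧\\ /∧ x y z = /∧ z x y

module _ {c ℓ : Level} (A : DistributiveResiduatedBinar c ℓ) where
  open ResiduatedBinarProperties
  open MirrorProperties

  \\∨-/∧⇒∨/ : \\∨-id A → /∧-id A → ∨/-id A
  \\∨-/∧⇒∨/ \\∨ /∧ =
    \\∨⇒mirror-∨/ (mirror A) (∨/-∧\\⇒\\∨ (mirror A) (\\∨⇒mirror-∨/ A \\∨) (/∧⇒mirror-∧\\ A /∧))

  ∧·-\\∨⇒∧\\ : ∧·-id A → \\∨-id A → ∧\\-id A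
  ∧·-\\∨⇒∧\\ ∧· \\∨ =
    /∧⇒mirror-∧\\ (mirror A) (·∧-∨/⇒/∧ (mirror A) (∧·⇒mirror-·∧ A ∧·) (\\∨⇒mirror-∨/ A \\∨))

  /∧-∧·⇒·∧ : /∧-id A → ∧·-id A → ·∧-id A
  /∧-∧·⇒·∧ /∧ ∧· =
    ∧·⇒mirror-·∧ (mirror A) (∧\\-·∧⇒∧· (mirror A) (/∧⇒mirror-∧\\ A /∧) (∧·⇒mirror-·∧ A ∧·))

theorem2p3 : {c ℓ : Level} (A : DistributiveResiduatedBinar c ℓ) →
    ((∨/-id A → ∧\\-id A → \\∨-id A) ×
     (\\∨-id A → /∧-id A → ∨/-id A) ×
     (·∧-id A → ∨/-id A → /∧-id A) ×
     (∧·-id A → \\∨-id A → ∧\\-id A) ×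
     (∧\\-id A → ·∧-id A → ∧·-id A) ×
     (/∧-id A → ∧·-id A → ·∧-id A))
theorem2p3 A = ∨/-∧\\⇒\\∨ A , \\∨-/∧⇒∨/ A , ·∧-∨/⇒/∧ A , ∧·-\\∨⇒∧\\ A , ∧\\-·∧⇒∧· A , /∧-∧·⇒·∧ A
  where open ResiduatedBinarProperties
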